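{- Let $X,Y$ be $\mathfrak{Q}$-preordered $\mathfrak{Q}$-subsets. (1) Every $\mathfrak{Q}$-Galois connection $f\dashv g$ with $f\colon\mathsf{P}X\to\mathsf{P}^\dagger Y$, $g\colon\mathsf{P}^\dagger Y\to\mathsf{P}X$ (a $\mathfrak{Q}$-polarity from $X$ to $Y$) is of the form $\phi_\uparrow\dashv\phi^\downarrow$ for some $\mathfrak{Q}$-distributor $\phi\colon X\nrightarrow Y$. (2) Every $\mathfrak{Q}$-Galois connection $f\dashv g$ with $f\colon\mathsf{P}X\to\mathsf{P}Y$, $g\colon\mathsf{P}Y\to\mathsf{P}X$ (a $\mathfrak{Q}$-axiality from $X$ to $Y$) is of the form $\phi^*\dashv\phi_*$ for some $\mathfrak{Q}$-distributor $\phi\colon Y\nrightarrow X$. (3) Every $\mathfrak{Q}$-Galois connection $f\dashv g$ with $f\colon\mathsf{P}^\dagger X\to\mathsf{P}^\dagger Y$, $g\colon\mathsf{P}^\dagger Y\to\mathsf{P}^\dagger X$ (a dual $\mathfrak{Q}$-axiality from $X$ to $Y$) is of the form $\phi_\dagger\dashv\phi^\dagger$ for some $\mathfrak{Q}$-distributor $\phi\colon Y\nrightarrow X$.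
   Context: $(\mathfrak{Q},\&,e)$ is a unital quantale (complete lattice with an associative multiplication $\&$ with unit $e$, distributing over arbitrary joins in each variable), assumed non-trivial ($\bot<e$). Implications: $p\& q\le r\iff p\le r/q\iff q\le p\backslash r$. $\mathcal{D}\mathfrak{Q}(p,q)=\{u\in\mathfrak{Q}: (u/p)\& p=u=q\&(q\backslash u)\}$. A $\mathfrak{Q}$-subset is a set $X$ with a map $|\cdot|\colon X\to\mathfrak{Q}$. A $\mathfrak{Q}$-relation $\phi\colon X\nrightarrow Y$ is a map $X\times Y\to\mathfrak{Q}$ with $\phi(x,y)\in\mathcal{D}\mathfrak{Q}(|x|,|y|)$. Composition: $(\psi\circ\phi)(x,z)=\bigvee_{y}(\psi(y,z)/|y|)\&\phi(x,y)$; identity $\mathrm{id}_X(x,x')=|x|$ if $x=x'$, $\bot$ otherwise; pointwise order. $\xi\swarrow\phi$ (for $\phi\colon X\nrightarrow Y$, $\xi\colon X\nrightarrow Z$) is the join of all $\psi'\colon Y\nrightarrow Z$ with $\psi'\circ\phi\le\xi$; $\psi\searrow\xi$ (for $\psi\colon Y\nrightarrow Z$) is the join of all $\phi'\colon X\nrightarrow Y$ with $\psi\circ\phi'\le\xi$. $\mathbf{1}_q$ is the singleton $\{*\}$ with $|*|=q$. A $\mathfrak{Q}$-preordered $\mathfrak{Q}$-subset is a $\mathfrak{Q}$-subset $X$ with $1_X^\natural\colon X\nrightarrow X$, $\mathrm{id}_X\le 1_X^\natural$, $1_X^\natural\circ 1_X^\natural\le 1_X^\natural$. $\mathfrak{Q}$-order-preserving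 map: $|fx|=|x|$ and $1_X^\natural(x,x')\le 1_Y^\natural(fx,fx')$. Underlying preorder: $x\le y$ iff $|x|=|y|$ and $|x|\le 1_X^\natural(x,y)$; maps compared pointwise. $\mathfrak{Q}$-Galois connection $f\dashv g$: $\mathfrak{Q}$-order-preserving $f,g$ with $1\le gf$, $fg\le 1$. $\mathfrak{Q}$-distributor $\phi\colon X\nrightarrow Y$: $\mathfrak{Q}$-relation with $1_Y^\natural\circ\phi\circ 1_X^\natural\le\phi$. $\mathsf{P}X$: all $\mu\colon X\nrightarrow\mathbf{1}_q$ ($q\in\mathfrak{Q}$) with $\mu\circ 1_X^\natural\le\mu$, $|\mu|=q$, $1_{\mathsf{P}X}^\natural(\mu,\mu')=\mu'\swarrow\mu$. $\mathsf{P}^\dagger X$: all $\lambda\colon\mathbf{1}_q\nrightarrow X$ with $1_X^\natural\circ\lambda\le\lambda$, $|\lambda|=q$, $1_{\mathsf{P}^\dagger X}^\natural(\lambda,\lambda')=\lambda'\searrow\lambda$. For a $\mathfrak{Q}$-distributor $\phi\colon X\nrightarrow Y$: $\phi_\uparrow\colon\mathsf{P}X\to\mathsf{P}^\dagger Y$, $\mu\mapsto\phi\swarrow\mu$; $\phi^\downarrow\colon\mathsf{P}^\dagger Y\to\mathsf{P}X$, $\lambda'\mapsto\lambda'\searrow\phi$; $\phi^*\colon\mathsf{P}Y\to\mathsf{P}X$, $\mu'\mapsto\mu'\circ\phi$; $\phi_*\colon\mathsf{P}X\to\mathsf{P}Y$, $\mu\mapsto\mu\swarrow\phi$; $\phi_\dagger\colon\mathsf{P}^\dagger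 Y\to\mathsf{P}^\dagger X$, $\lambda'\mapsto\phi\searrow\lambda'$; $\phi^\dagger\colon\mathsf{P}^\dagger X\to\mathsf{P}^\dagger Y$, $\lambda\mapsto\phi\circ\lambda$ (these form $\mathfrak{Q}$-Galois connections $\phi_\uparrow\dashv\phi^\downarrow$, $\phi^*\dashv\phi_*$, $\phi_\dagger\dashv\phi^\dagger$). -}

module Defs where

open import Data.Empty using (⊥)
open import Data.Unit using (⊤; tt)
open import Data.Product using (Σ; _×_; _,_; proj₁; proj₂)
open import Relation.Binary.PropositionalEquality using (_≡_)
open import Relation.Nullary using (¬_)

record Quantale : Set₁ where
  infixl 7 _&_
  infix  4 _≤_
  field
    Q        : Set
    _≤_      : Q → Q → Set
    ≤-refl   : ∀ {p} → p ≤ p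
    ≤-trans  : ∀ {p q r} → p ≤ q → q ≤ r → p ≤ r
    ≤-antisym : ∀ {p q} → p ≤ q → q ≤ p → p ≡ q
    ⋁        : {I : Set} → (I → Q) → Q
    ⋁-ub     : ∀ {I : Set} (a : I → Q) (i : I) → a i ≤ ⋁ a
    ⋁-least  : ∀ {I : Set} (a : I → Q) (p : Q) → (∀ i → a i ≤ p) → ⋁ a ≤ p
    _&_      : Q → Q → Q
    e        : Q
    &-assoc  : ∀ p q r → (p & q) & r ≡ p & (q & r)
    &-unitˡ  : ∀ p → e & p ≡ p
    &-unitʳ  : ∀ p → p & e ≡ p
    &-⋁ˡ     : ∀ p {I : Set} (a : I → Q) → p & ⋁ a ≡ ⋁ (λ i → p & a i)
    ⋁-&ʳ     : ∀ p {I : Set} (a : I → Q) → ⋁ a & p ≡ ⋁ (λ i → a i & p)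
    _/_      : Q → Q → Q
    _∖_      : Q → Q → Q
    /-intro  : ∀ {p q r} → p & q ≤ r → p ≤ r / q
    /-elim   : ∀ {p q r} → p ≤ r / q → p & q ≤ r
    ∖-intro  : ∀ {p q r} → p & q ≤ r → q ≤ p ∖ r
    ∖-elim   : ∀ {p q r} → q ≤ p ∖ r → p & q ≤ r

  ⊥Q : Q
  ⊥Q = ⋁ {⊥} (λ ())

  field
    nontrivial : ¬ (⊥Q ≡ e)

module QTheory (𝔔 : Quantale) where
  open Quantale 𝔔

  D : Q → Q → Q → Set
  D p q u = ((u / p) & p ≡ u) × (q & (q ∖ u) ≡ u)

  record QSet : Set₁ where
    constructor qset
    field
      El  : Set
      ∣_∣ : El → Q
  open QSet public

  𝟏 : Q → QSet
  𝟏 q = qset ⊤ (λ _ → q)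

  Raw : QSet → QSet → Set
  Raw X Y = El X → El Y → Q

  LeR : (X Y : QSet) → Raw X Y → Raw X Y → Set
  LeR X Y φ ψ = ∀ (x : El X) (y : El Y) → φ x y ≤ ψ x y

  IsQRel : (X Y : QSet) → Raw X Y → Set
  IsQRel X Y φ = ∀ x y → D (∣ X ∣ x) (∣ Y ∣ y) (φ x y)

  record QRel (X Y : QSet) : Set where
    constructor qrel
    field
      rel  : Raw X Y
      isQ  : IsQRel X Y rel
  open QRel public

  comp : (X Y Z : QSet) → Raw Y Z → Raw X Y → Raw X Z
  comp X Y Z ψ φ x z = ⋁ {El Y} (λ y → (ψ y z / ∣ Y ∣ y) & φ x y)

  -- identity: |x| if x = x', ⊥ otherwise (written as the join over the
  -- proofs of x ≡ x', which avoids assuming decidable equality)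
  idR : (X : QSet) → Raw X X
  idR X x x' = ⋁ {x ≡ x'} (λ _ → ∣ X ∣ x)

  lift : (X Y Z : QSet) → Raw X Z → Raw X Y → Raw Y Z
  lift X Y Z ξ φ y z =
    ⋁ {Σ (QRel Y Z) (λ ψ' → LeR X Z (comp X Y Z (rel ψ') φ) ξ)} (λ w → rel (proj₁ w) y z)

  ext : (X Y Z : QSet) → Raw Y Z → Raw X Z → Raw X Y
  ext X Y Z ψ ξ x y =
    ⋁ {Σ (QRel X Y) (λ φ' → LeR X Z (comp X Y Z ψ (rel φ')) ξ)} (λ w → rel (proj₁ w) x y)

  record QPreSet : Set₁ where
    constructor qpre
    field
      sub : QSet
      hom : Raw sub sub
  open QPreSet public

  IsQPreordered : QPreSet → Set
  IsQPreordered P =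
    IsQRel (sub P) (sub P) (hom P)
    × LeR (sub P) (sub P) (idR (sub P)) (hom P)
    × LeR (sub P) (sub P) (comp (sub P) (sub P) (sub P) (hom P) (hom P)) (hom P)

  Elt : QPreSet → Set
  Elt P = El (sub P)

  IsQOrderPreserving : (P R : QPreSet) → (Elt P → Elt R) → Set
  IsQOrderPreserving P R f =
    (∀ x → ∣ sub R ∣ (f x) ≡ ∣ sub P ∣ x)
    × (∀ x x' → hom P x x' ≤ hom R (f x) (f x'))

  Below : (P : QPreSet) → Elt P → Elt P → Set
  Below P x y = (∣ sub P ∣ x ≡ ∣ sub P ∣ y) × (∣ sub P ∣ x ≤ hom P x y)

  IsQGalois : (P R : QPreSet) → (Elt P → Elt R) → (Elt R → Elt P) → Set
  IsQGalois P R f g =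
    IsQOrderPreserving P R f
    × IsQOrderPreserving R P g
    × (∀ x → Below P x (g (f x)))
    × (∀ y → Below R (f (g y)) y)

  IsDistributor : (X Y : QPreSet) → QRel (sub X) (sub Y) → Set
  IsDistributor X Y φ =
    LeR (sub X) (sub Y)
      (comp (sub X) (sub X) (sub Y)
            (comp (sub X) (sub Y) (sub Y) (hom Y) (rel φ)) (hom X))
      (rel φ)

  PEl : QPreSet → Set
  PEl X = Σ Q (λ q → Σ (QRel (sub X) (𝟏 q))
                  (λ μ → LeR (sub X) (𝟏 q) (comp (sub X) (sub X) (𝟏 q) (rel μ) (hom X)) (rel μ)))

  P : QPreSet → QPreSet
  P X = qpre (qset (PEl X) proj₁)
             (λ μ μ' → lift (sub X) (𝟏 (proj₁ μ)) (𝟏 (proj₁ μ'))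
                            (rel (proj₁ (proj₂ μ'))) (rel (proj₁ (proj₂ μ))) tt tt)

  P†El : QPreSet → Set
  P†El X = Σ Q (λ q → Σ (QRel (𝟏 q) (sub X))
                  (λ l → LeR (𝟏 q) (sub X) (comp (𝟏 q) (sub X) (sub X) (hom X) (rel l)) (rel l)))

  P† : QPreSet → QPreSet
  P† X = qpre (qset (P†El X) proj₁)
              (λ l l' → ext (𝟏 (proj₁ l)) (𝟏 (proj₁ l')) (sub X)
                            (rel (proj₁ (proj₂ l'))) (rel (proj₁ (proj₂ l))) tt tt)

  μrel : ∀ {X : QPreSet} (μ : PEl X) → Raw (sub X) (𝟏 (proj₁ μ))
  μrel μ = rel (proj₁ (proj₂ μ))
  λrel : ∀ {X : QPreSet} (l : P†El X) → Raw (𝟏 (proj₁ l)) (sub X)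
  λrel l = rel (proj₁ (proj₂ l))

  φ↑ : (X Y : QPreSet) → QRel (sub X) (sub Y) → (μ : PEl X) → Raw (𝟏 (proj₁ μ)) (sub Y)
  φ↑ X Y φ μ = lift (sub X) (𝟏 (proj₁ μ)) (sub Y) (rel φ) (μrel μ)

  φ↓ : (X Y : QPreSet) → QRel (sub X) (sub Y) → (l : P†El Y) → Raw (sub X) (𝟏 (proj₁ l))
  φ↓ X Y φ l = ext (sub X) (𝟏 (proj₁ l)) (sub Y) (λrel l) (rel φ)

  φ* : (X Y : QPreSet) → QRel (sub X) (sub Y) → (μ' : PEl Y) → Raw (sub X) (𝟏 (proj₁ μ'))
  φ* X Y φ μ' = comp (sub X) (sub Y) (𝟏 (proj₁ μ')) (μrel μ') (rel φ)

  φ₊ : (X Y : QPreSet) → QRel (sub X) (sub Y) → (μ : PEl X) → Raw (sub Y) (𝟏 (proj₁ μ))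
  φ₊ X Y φ μ = lift (sub X) (sub Y) (𝟏 (proj₁ μ)) (μrel μ) (rel φ)

  φ†₋ : (X Y : QPreSet) → QRel (sub X) (sub Y) → (l : P†El Y) → Raw (𝟏 (proj₁ l)) (sub X)
  φ†₋ X Y φ l = ext (𝟏 (proj₁ l)) (sub X) (sub Y) (rel φ) (λrel l)

  φ†⁺ : (X Y : QPreSet) → QRel (sub X) (sub Y) → (l : P†El X) → Raw (𝟏 (proj₁ l)) (sub Y)
  φ†⁺ X Y φ l = comp (𝟏 (proj₁ l)) (sub X) (sub Y) (rel φ) (λrel l)

  -- "h is the map m": an element h a of P Z (resp. P† Z) agrees with the
  -- prescribed value: same weight q = |a|, same underlying 𝔔-relation.

  AgreesP : ∀ {A : Set} (Z : QPreSet) (wA : A → Q) (h : A → PEl Z)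
            (m : (a : A) → Raw (sub Z) (𝟏 (wA a))) → Set
  AgreesP {A} Z wA h m =
    ∀ (a : A) → (proj₁ (h a) ≡ wA a) × (∀ z t → μrel (h a) z t ≡ m a z t)

  AgreesP† : ∀ {A : Set} (Z : QPreSet) (wA : A → Q) (h : A → P†El Z)
             (m : (a : A) → Raw (𝟏 (wA a)) (sub Z)) → Set
  AgreesP† {A} Z wA h m =
    ∀ (a : A) → (proj₁ (h a) ≡ wA a) × (∀ t z → λrel (h a) t z ≡ m a t z)

-- Each of the three Galois connections is recovered from its values on representables.
-- For an axiality f ⊣ g : P X ⇄ P Y put φ(y,x) = f(y_x)(y), where y_x = 1_X(-,x) is the
-- representable presheaf at x.  Every μ ∈ P X is the join of its representable parts and the
-- left adjoint f preserves them, so μ ∘ φ ≤ f μ; conversely g ν contains every ρ with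
-- ρ ∘ φ ≤ ν, because 1(f y_x, ν) ≤ 1(y_x, g ν) = (g ν)(x).  These two inequalities give
-- f = φ* and g = φ_*.  The polarity case uses φ(x,y) = f(y_x)(y) in the same way, and the
-- dual axiality case is the mirror image, with φ(y,x) = g(y^y)(x) for the corepresentables
-- y^y = 1_Y(y,-) and the roles of f and g exchanged.
module Submission where

open import Defs
open import Data.Unit using (tt)
open import Data.Product using (Σ; _×_; _,_; proj₁; proj₂)
open import Level using (0ℓ)
open import Relation.Binary.Bundles using (Poset)
open import Relation.Binary.PropositionalEquality
  using (_≡_; refl; sym; trans; subst; isEquivalence)

module _ (𝔔 : Quantale) where
  open Quantale 𝔔
  open QTheory 𝔔

  ≤-reflexive : ∀ {a b} → a ≡ b → a ≤ b
  ≤-reflexive refl = ≤-refl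

  ≤-poset : Poset 0ℓ 0ℓ 0ℓ
  ≤-poset = record
    { Carrier = Q ; _≈_ = _≡_ ; _≤_ = _≤_
    ; isPartialOrder = record
      { isPreorder = record
        { isEquivalence = isEquivalence ; reflexive = ≤-reflexive ; trans = ≤-trans }
      ; antisym = ≤-antisym } }

  open import Relation.Binary.Reasoning.PartialOrder ≤-poset

  /-cancelʳ : ∀ {a p} → (a / p) & p ≤ a
  /-cancelʳ = /-elim ≤-refl

  ∖-cancelˡ : ∀ {a p} → p & (p ∖ a) ≤ a
  ∖-cancelˡ = ∖-elim ≤-refl

  &-monoˡ : ∀ {a b c} → a ≤ b → a & c ≤ b & c
  &-monoˡ a≤b = /-elim (≤-trans a≤b (/-intro ≤-refl))

  &-monoʳ : ∀ {a b c} → a ≤ b → c & a ≤ c & b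
  &-monoʳ a≤b = ∖-elim (≤-trans a≤b (∖-intro ≤-refl))

  &-mono : ∀ {a b c d} → a ≤ b → c ≤ d → a & c ≤ b & d
  &-mono a≤b c≤d = ≤-trans (&-monoˡ a≤b) (&-monoʳ c≤d)

  /-monoˡ : ∀ {a b c} → a ≤ b → a / c ≤ b / c
  /-monoˡ a≤b = /-intro (≤-trans /-cancelʳ a≤b)

  ∖-monoʳ : ∀ {a b c} → a ≤ b → c ∖ a ≤ c ∖ b
  ∖-monoʳ a≤b = ∖-intro (≤-trans ∖-cancelˡ a≤b)

  &-assoc-≤ : ∀ {a b c} → (a & b) & c ≤ a & (b & c)
  &-assoc-≤ {a} {b} {c} = ≤-reflexive (&-assoc a b c)

  &-assoc-≥ : ∀ {a b c} → a & (b & c) ≤ (a & b) & c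
  &-assoc-≥ {a} {b} {c} = ≤-reflexive (sym (&-assoc a b c))

  ≤-p/p& : ∀ {p a} → a ≤ (p / p) & a
  ≤-p/p& {p} {a} = begin
    a           ≡⟨ &-unitˡ a ⟨
    e & a       ≤⟨ &-monoˡ (/-intro (≤-reflexive (&-unitˡ p))) ⟩
    (p / p) & a ∎

  ≤-⋁ : ∀ {I : Set} {a : I → Q} {p} (i : I) → p ≤ a i → p ≤ ⋁ a
  ≤-⋁ {a = a} i p≤aᵢ = ≤-trans p≤aᵢ (⋁-ub a i)

  ⋁-lub : ∀ {I : Set} {a : I → Q} {p} → (∀ i → a i ≤ p) → ⋁ a ≤ p
  ⋁-lub {a = a} {p} = ⋁-least a p

  ⋁-mono : ∀ {I : Set} {a b : I → Q} → (∀ i → a i ≤ b i) → ⋁ a ≤ ⋁ b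
  ⋁-mono a≤b = ⋁-lub (λ i → ≤-⋁ i (a≤b i))

  &-⋁-lub : ∀ {p r} {I : Set} {a : I → Q} → (∀ i → p & a i ≤ r) → p & ⋁ a ≤ r
  &-⋁-lub {p} {a = a} h = ≤-trans (≤-reflexive (&-⋁ˡ p a)) (⋁-lub h)

  ⋁-&-lub : ∀ {p r} {I : Set} {a : I → Q} → (∀ i → a i & p ≤ r) → ⋁ a & p ≤ r
  ⋁-&-lub {p} {a = a} h = ≤-trans (≤-reflexive (⋁-&ʳ p a)) (⋁-lub h)

  -- The two halves of u ∈ 𝒟𝔔(p,q); the reverse inequalities always hold.
  Dˡ : Q → Q → Set
  Dˡ p u = u ≤ (u / p) & p

  Dʳ : Q → Q → Set
  Dʳ q u = u ≤ q & (q ∖ u)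

  D⇒Dˡ : ∀ {p q u} → D p q u → Dˡ p u
  D⇒Dˡ (l , _) = ≤-reflexive (sym l)

  D⇒Dʳ : ∀ {p q u} → D p q u → Dʳ q u
  D⇒Dʳ (_ , r) = ≤-reflexive (sym r)

  Dˡ∧Dʳ⇒D : ∀ {p q u} → Dˡ p u → Dʳ q u → D p q u
  Dˡ∧Dʳ⇒D l r = ≤-antisym /-cancelʳ l , ≤-antisym ∖-cancelˡ r

  D-⋁ : ∀ {p q} {I : Set} {a : I → Q} → (∀ i → D p q (a i)) → D p q (⋁ a)
  D-⋁ {a = a} h = Dˡ∧Dʳ⇒D
    (⋁-lub (λ i → ≤-trans (D⇒Dˡ (h i)) (&-monoˡ (/-monoˡ (⋁-ub a i)))))
    (⋁-lub (λ i → ≤-trans (D⇒Dʳ (h i)) (&-monoʳ (∖-monoʳ (⋁-ub a i)))))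

  D-refl : ∀ {q} → D q q q
  D-refl {q} = Dˡ∧Dʳ⇒D ≤-p/p& (begin
    q           ≡⟨ &-unitʳ q ⟨
    q & e       ≤⟨ &-monoʳ (∖-intro (≤-reflexive (&-unitʳ q))) ⟩
    q & (q ∖ q) ∎)

  /&≤&∖ : ∀ {a p b} → Dʳ p b → (a / p) & b ≤ a & (p ∖ b)
  /&≤&∖ {a} {p} {b} b∈Dʳ = begin
    (a / p) & b             ≤⟨ &-monoʳ b∈Dʳ ⟩
    (a / p) & (p & (p ∖ b)) ≤⟨ &-assoc-≥ ⟩
    ((a / p) & p) & (p ∖ b) ≤⟨ &-monoˡ /-cancelʳ ⟩
    a & (p ∖ b)             ∎

  &∖≤/& : ∀ {a p b} → Dˡ p a → a & (p ∖ b) ≤ (a / p) & b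
  &∖≤/& {a} {p} {b} a∈Dˡ = begin
    a & (p ∖ b)             ≤⟨ &-monoˡ a∈Dˡ ⟩
    ((a / p) & p) & (p ∖ b) ≤⟨ &-assoc-≤ ⟩
    (a / p) & (p & (p ∖ b)) ≤⟨ &-monoʳ ∖-cancelˡ ⟩
    (a / p) & b             ∎

  IsQRel-reweightʳ : ∀ {X : QSet} {p q} {ρ : Raw X (𝟏 p)} →
                     p ≡ q → IsQRel X (𝟏 p) ρ → IsQRel X (𝟏 q) ρ
  IsQRel-reweightʳ refl ρ-isQRel = ρ-isQRel

  IsQRel-reweightˡ : ∀ {Y : QSet} {p q} {ρ : Raw (𝟏 p) Y} →
                     p ≡ q → IsQRel (𝟏 p) Y ρ → IsQRel (𝟏 q) Y ρ
  IsQRel-reweightˡ refl ρ-isQRel = ρ-isQRel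

  module _ {X Y Z : QSet} where

    comp-mono : ∀ {ψ ψ' : Raw Y Z} {φ φ' : Raw X Y} → LeR Y Z ψ ψ' → LeR X Y φ φ' →
                LeR X Z (comp X Y Z ψ φ) (comp X Y Z ψ' φ')
    comp-mono ψ≤ψ' φ≤φ' x z = ⋁-mono (λ y → &-mono (/-monoˡ (ψ≤ψ' y z)) (φ≤φ' x y))

    comp-isQRel : ∀ {ψ : Raw Y Z} {φ : Raw X Y} → IsQRel Y Z ψ → IsQRel X Y φ →
                  IsQRel X Z (comp X Y Z ψ φ)
    comp-isQRel {ψ} {φ} ψ-isQRel φ-isQRel x z = D-⋁ (λ y → Dˡ∧Dʳ⇒D (left y) (right y))
      where
      left : ∀ y → Dˡ (∣ X ∣ x) ((ψ y z / ∣ Y ∣ y) & φ x y)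
      left y = ≤-trans (&-monoʳ (D⇒Dˡ (φ-isQRel x y)))
        (≤-trans &-assoc-≥ (&-monoˡ (/-intro (≤-trans &-assoc-≤ (&-monoʳ /-cancelʳ)))))
      right : ∀ y → Dʳ (∣ Z ∣ z) ((ψ y z / ∣ Y ∣ y) & φ x y)
      right y = ≤-trans (/&≤&∖ (D⇒Dʳ (φ-isQRel x y)))
        (≤-trans (&-monoˡ (D⇒Dʳ (ψ-isQRel y z)))
        (≤-trans &-assoc-≤ (&-monoʳ (∖-intro (≤-trans &-assoc-≥
          (≤-trans (&-monoˡ ∖-cancelˡ) (&∖≤/& (D⇒Dˡ (ψ-isQRel y z)))))))))

    lift-comp-≤ : ∀ {ξ : Raw X Z} {φ : Raw X Y} → IsQRel X Y φ →
                  LeR X Z (comp X Y Z (lift X Y Z ξ φ) φ) ξ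
    lift-comp-≤ φ-isQRel x z = ⋁-lub λ y →
      ≤-trans (/&≤&∖ (D⇒Dʳ (φ-isQRel x y))) (⋁-&-lub λ (ψ , ψ∘φ≤ξ) →
        ≤-trans (&∖≤/& (D⇒Dˡ (isQ ψ y z))) (≤-trans (≤-⋁ y ≤-refl) (ψ∘φ≤ξ x z)))

    lift-greatest : ∀ {ξ : Raw X Z} {φ : Raw X Y} (ψ : QRel Y Z) →
                    LeR X Z (comp X Y Z (rel ψ) φ) ξ → LeR Y Z (rel ψ) (lift X Y Z ξ φ)
    lift-greatest ψ ψ∘φ≤ξ y z = ≤-⋁ (ψ , ψ∘φ≤ξ) ≤-refl

    lift-isQRel : ∀ {ξ : Raw X Z} {φ : Raw X Y} → IsQRel Y Z (lift X Y Z ξ φ)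
    lift-isQRel y z = D-⋁ (λ (ψ , _) → isQ ψ y z)

    ext-comp-≤ : ∀ {ψ : Raw Y Z} {ξ : Raw X Z} → LeR X Z (comp X Y Z ψ (ext X Y Z ψ ξ)) ξ
    ext-comp-≤ x z = ⋁-lub λ y → &-⋁-lub λ (φ , ψ∘φ≤ξ) →
      ≤-trans (≤-⋁ y ≤-refl) (ψ∘φ≤ξ x z)

    ext-greatest : ∀ {ψ : Raw Y Z} {ξ : Raw X Z} (φ : QRel X Y) →
                   LeR X Z (comp X Y Z ψ (rel φ)) ξ → LeR X Y (rel φ) (ext X Y Z ψ ξ)
    ext-greatest φ ψ∘φ≤ξ x y = ≤-⋁ (φ , ψ∘φ≤ξ) ≤-refl

  module _ {W X Y Z : QSet} {c : Raw Y Z} {b : Raw X Y} {a : Raw W X} where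

    comp-assoc-≤ : LeR W Z (comp W Y Z c (comp W X Y b a)) (comp W X Z (comp X Y Z c b) a)
    comp-assoc-≤ w z = ⋁-lub λ y → &-⋁-lub λ x →
      ≤-trans &-assoc-≥ (≤-⋁ x (&-monoˡ (/-intro
        (≤-trans &-assoc-≤ (≤-trans (&-monoʳ /-cancelʳ) (≤-⋁ y ≤-refl))))))

    comp-assoc-≥ : IsQRel X Y b → IsQRel W X a →
                   LeR W Z (comp W X Z (comp X Y Z c b) a) (comp W Y Z c (comp W X Y b a))
    comp-assoc-≥ b-isQRel a-isQRel w z = ⋁-lub λ x →
      ≤-trans (/&≤&∖ (D⇒Dʳ (a-isQRel w x))) (⋁-&-lub λ y →
        ≤-⋁ y (≤-trans &-assoc-≤ (&-monoʳ
          (≤-trans (&∖≤/& (D⇒Dˡ (b-isQRel x y))) (≤-⋁ x ≤-refl)))))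

  closed⇒IsDistributor : (X Y : QPreSet) (φ : QRel (sub X) (sub Y)) →
    LeR (sub X) (sub Y) (comp (sub X) (sub Y) (sub Y) (hom Y) (rel φ)) (rel φ) →
    LeR (sub X) (sub Y) (comp (sub X) (sub X) (sub Y) (rel φ) (hom X)) (rel φ) →
    IsDistributor X Y φ
  closed⇒IsDistributor X Y φ 1∘φ≤φ φ∘1≤φ x y =
    ≤-trans (comp-mono {X = sub X} {Y = sub X} {Z = sub Y} {φ = hom X} 1∘φ≤φ (λ _ _ → ≤-refl) x y)
            (φ∘1≤φ x y)

  module PresheafHom (X : QPreSet) where

    relᴾ : (μ : PEl X) → QRel (sub X) (𝟏 (proj₁ μ))
    relᴾ μ = proj₁ (proj₂ μ)

    -- The weight |μ| is generalised to any w equal to it, so that callers need not transport.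
    homP-sound : (μ ν : PEl X) (x : Elt X) {w : Q} → proj₁ μ ≡ w →
                 (hom (P X) μ ν / w) & μrel μ x tt ≤ μrel ν x tt
    homP-sound μ ν x refl = ≤-trans (≤-⋁ tt ≤-refl)
      (lift-comp-≤ {X = sub X} {Y = 𝟏 (proj₁ μ)} {Z = 𝟏 (proj₁ ν)} (isQ (relᴾ μ)) x tt)

    homP-greatest : (μ ν : PEl X) (u : Q) {w : Q} → proj₁ μ ≡ w → D w (proj₁ ν) u →
                    (∀ x → (u / w) & μrel μ x tt ≤ μrel ν x tt) → u ≤ hom (P X) μ ν
    homP-greatest μ ν u refl u∈D h =
      lift-greatest {X = sub X} {Y = 𝟏 (proj₁ μ)} {Z = 𝟏 (proj₁ ν)}
        (qrel (λ _ _ → u) (λ _ _ → u∈D)) (λ x _ → ⋁-lub (λ _ → h x)) tt tt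

    homP-Dˡ : (μ ν : PEl X) → Dˡ (proj₁ μ) (hom (P X) μ ν)
    homP-Dˡ μ ν = D⇒Dˡ (lift-isQRel {X = sub X} {Y = 𝟏 (proj₁ μ)} {Z = 𝟏 (proj₁ ν)} tt tt)

    Below⇒≤ : (μ ν : PEl X) → Below (P X) μ ν → ∀ x → μrel μ x tt ≤ μrel ν x tt
    Below⇒≤ μ ν (_ , ∣μ∣≤hom) x =
      ≤-trans ≤-p/p& (≤-trans (&-monoˡ (/-monoˡ ∣μ∣≤hom)) (homP-sound μ ν x refl))

    ≤⇒Below : (μ ν : PEl X) → proj₁ μ ≡ proj₁ ν →
              (∀ x → μrel μ x tt ≤ μrel ν x tt) → Below (P X) μ ν
    ≤⇒Below μ ν eq μ≤ν = eq ,
      homP-greatest μ ν (proj₁ μ) refl (subst (λ w → D (proj₁ μ) w (proj₁ μ)) eq D-refl)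
        (λ x → ≤-trans (/&≤&∖ (D⇒Dʳ (isQ (relᴾ μ) x tt))) (≤-trans ∖-cancelˡ (μ≤ν x)))

    homP-≤-at : (μ ν : PEl X) (x : Elt X) → proj₁ μ ≤ μrel μ x tt →
                hom (P X) μ ν ≤ μrel ν x tt
    homP-≤-at μ ν x ∣μ∣≤μx =
      ≤-trans (homP-Dˡ μ ν) (≤-trans (&-monoʳ ∣μ∣≤μx) (homP-sound μ ν x refl))

  module PresheafHom† (X : QPreSet) where

    rel† : (l : P†El X) → QRel (𝟏 (proj₁ l)) (sub X)
    rel† l = proj₁ (proj₂ l)

    homP†-sound : (l l' : P†El X) (x : Elt X) {w : Q} → proj₁ l' ≡ w →
                  (λrel l' tt x / w) & hom (P† X) l l' ≤ λrel l tt x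
    homP†-sound l l' x refl = ≤-trans (≤-⋁ tt ≤-refl)
      (ext-comp-≤ {X = 𝟏 (proj₁ l)} {Y = 𝟏 (proj₁ l')} {Z = sub X} tt x)

    homP†-greatest : (l l' : P†El X) (u : Q) {w : Q} → proj₁ l' ≡ w → D (proj₁ l) w u →
                     (∀ x → (λrel l' tt x / w) & u ≤ λrel l tt x) → u ≤ hom (P† X) l l'
    homP†-greatest l l' u refl u∈D h =
      ext-greatest {X = 𝟏 (proj₁ l)} {Y = 𝟏 (proj₁ l')} {Z = sub X}
        (qrel (λ _ _ → u) (λ _ _ → u∈D)) (λ _ x → ⋁-lub (λ _ → h x)) tt tt

    Below⇒≥ : (l l' : P†El X) → Below (P† X) l l' → ∀ x → λrel l' tt x ≤ λrel l tt x
    Below⇒≥ l l' (refl , ∣l∣≤hom) x =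
      ≤-trans (D⇒Dˡ (isQ (rel† l') tt x))
        (≤-trans (&-monoʳ ∣l∣≤hom) (homP†-sound l l' x refl))

    ≥⇒Below : (l l' : P†El X) → proj₁ l ≡ proj₁ l' →
              (∀ x → λrel l' tt x ≤ λrel l tt x) → Below (P† X) l l'
    ≥⇒Below l l' refl l'≤l = refl ,
      homP†-greatest l l' (proj₁ l) refl D-refl
        (λ x → ≤-trans (&-monoˡ (/-monoˡ (l'≤l x))) /-cancelʳ)

    homP†-≤-at : (l l' : P†El X) (x : Elt X) → proj₁ l' ≤ λrel l' tt x →
                 hom (P† X) l l' ≤ λrel l tt x
    homP†-≤-at l l' x ∣l'∣≤l'x =
      ≤-trans ≤-p/p& (≤-trans (&-monoˡ (/-monoˡ ∣l'∣≤l'x)) (homP†-sound l l' x refl))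

  comp-PEl : (Y X : QPreSet) → IsQRel (sub Y) (sub Y) (hom Y) → (φ : QRel (sub Y) (sub X)) →
             LeR (sub Y) (sub X) (comp (sub Y) (sub Y) (sub X) (rel φ) (hom Y)) (rel φ) →
             PEl X → PEl Y
  comp-PEl Y X 1-isQRel φ φ∘1≤φ μ =
    q , qrel (φ* Y X φ μ) (comp-isQRel (isQ (proj₁ (proj₂ μ))) (isQ φ)) , closed
    where
    q = proj₁ μ
    closed : LeR (sub Y) (𝟏 q) (comp (sub Y) (sub Y) (𝟏 q) (φ* Y X φ μ) (hom Y)) (φ* Y X φ μ)
    closed y t = ≤-trans
      (comp-assoc-≥ {W = sub Y} {X = sub Y} {Y = sub X} {Z = 𝟏 q}
                    {c = μrel μ} {b = rel φ} {a = hom Y} (isQ φ) 1-isQRel y t)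
      (comp-mono {X = sub Y} {Y = sub X} {Z = 𝟏 q} (λ _ _ → ≤-refl) φ∘1≤φ y t)

  comp-P†El : (X Y : QPreSet) {q : Q} (φ : QRel (sub X) (sub Y)) →
              LeR (sub X) (sub Y) (comp (sub X) (sub Y) (sub Y) (hom Y) (rel φ)) (rel φ) →
              QRel (𝟏 q) (sub X) → P†El Y
  comp-P†El X Y {q} φ 1∘φ≤φ l = q , qrel φ∘l (comp-isQRel (isQ φ) (isQ l)) , closed
    where
    φ∘l = comp (𝟏 q) (sub X) (sub Y) (rel φ) (rel l)
    closed : LeR (𝟏 q) (sub Y) (comp (𝟏 q) (sub Y) (sub Y) (hom Y) φ∘l) φ∘l
    closed t y = ≤-trans
      (comp-assoc-≤ {W = 𝟏 q} {X = sub X} {Y = sub Y} {Z = sub Y}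
                    {c = hom Y} {b = rel φ} {a = rel l} t y)
      (comp-mono {X = 𝟏 q} {Y = sub X} {Z = sub Y} 1∘φ≤φ (λ _ _ → ≤-refl) t y)

  Below-mono : (A B : QPreSet) {h : Elt A → Elt B} → IsQOrderPreserving A B h →
               ∀ {a a'} → Below A a a' → Below B (h a) (h a')
  Below-mono A B {h} (h-weight , h-hom) {a} {a'} (eq , ∣a∣≤hom) =
    trans (h-weight a) (trans eq (sym (h-weight a'))) ,
    ≤-trans (≤-reflexive (h-weight a)) (≤-trans ∣a∣≤hom (h-hom a a'))

  module GaloisConnection (A B : QPreSet) {f : Elt A → Elt B} {g : Elt B → Elt A}
                          (gal : IsQGalois A B f g) where

    f-weight : ∀ a → ∣ sub B ∣ (f a) ≡ ∣ sub A ∣ a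
    f-weight = proj₁ (proj₁ gal)

    f-hom : ∀ a a' → hom A a a' ≤ hom B (f a) (f a')
    f-hom = proj₂ (proj₁ gal)

    g-weight : ∀ b → ∣ sub A ∣ (g b) ≡ ∣ sub B ∣ b
    g-weight = proj₁ (proj₁ (proj₂ gal))

    g-hom : ∀ b b' → hom B b b' ≤ hom A (g b) (g b')
    g-hom = proj₂ (proj₁ (proj₂ gal))

    unit : ∀ a → Below A a (g (f a))
    unit = proj₁ (proj₂ (proj₂ gal))

    counit : ∀ b → Below B (f (g b)) b
    counit = proj₂ (proj₂ (proj₂ gal))

    f-Below : ∀ {a a'} → Below A a a' → Below B (f a) (f a')
    f-Below = Below-mono A B (proj₁ gal)

    g-Below : ∀ {b b'} → Below B b b' → Below A (g b) (g b')
    g-Below = Below-mono B A (proj₁ (proj₂ gal))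

  module Representables (X : QPreSet) (X-pre : IsQPreordered X) where
    open PresheafHom X
    open PresheafHom† X

    hom-isQRel : IsQRel (sub X) (sub X) (hom X)
    hom-isQRel = proj₁ X-pre

    hom-refl : ∀ x → ∣ sub X ∣ x ≤ hom X x x
    hom-refl x = ≤-trans (≤-⋁ refl ≤-refl) (proj₁ (proj₂ X-pre) x x)

    hom-trans : LeR (sub X) (sub X) (comp (sub X) (sub X) (sub X) (hom X) (hom X)) (hom X)
    hom-trans = proj₂ (proj₂ X-pre)

    yo : Elt X → PEl X
    yo x = ∣ sub X ∣ x , qrel (λ x' _ → hom X x' x) (λ x' _ → hom-isQRel x' x) ,
           λ x' _ → hom-trans x' x

    coyo : Elt X → P†El X
    coyo x = ∣ sub X ∣ x , qrel (λ _ x' → hom X x x') (λ _ x' → hom-isQRel x x') ,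
             λ _ x' → hom-trans x x'

    yoneda : ∀ μ x → μrel μ x tt ≤ hom (P X) (yo x) μ
    yoneda μ x = homP-greatest (yo x) μ (μrel μ x tt) refl (isQ (relᴾ μ) x tt)
      (λ x' → ≤-trans (≤-⋁ x ≤-refl) (proj₂ (proj₂ μ) x' tt))

    coyoneda : ∀ l x → λrel l tt x ≤ hom (P† X) l (coyo x)
    coyoneda l x = homP†-greatest l (coyo x) (λrel l tt x) refl (isQ (rel† l) tt x)
      (λ x' → ≤-trans (≤-⋁ x ≤-refl) (proj₂ (proj₂ l) tt x'))

    hom-f-yo≤g : (B : QPreSet) (f : PEl X → Elt B) (g : Elt B → PEl X) →
                 IsQGalois (P X) B f g → ∀ x b → hom B (f (yo x)) b ≤ μrel (g b) x tt
    hom-f-yo≤g B f g gal x b = ≤-trans (g-hom (f (yo x)) b)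
      (homP-≤-at (g (f (yo x))) (g b) x (begin
        proj₁ (g (f (yo x))) ≡⟨ proj₁ (unit (yo x)) ⟨
        ∣ sub X ∣ x          ≤⟨ hom-refl x ⟩
        hom X x x            ≤⟨ Below⇒≤ (yo x) (g (f (yo x))) (unit (yo x)) x ⟩
        μrel (g (f (yo x))) x tt ∎))
      where open GaloisConnection (P X) B gal

    hom-g-coyo≤f : (A : QPreSet) (f : Elt A → P†El X) (g : P†El X → Elt A) →
                   IsQGalois A (P† X) f g → ∀ x a → hom A a (g (coyo x)) ≤ λrel (f a) tt x
    hom-g-coyo≤f A f g gal x a = ≤-trans (f-hom a (g (coyo x)))
      (homP†-≤-at (f a) (f (g (coyo x))) x (begin
        proj₁ (f (g (coyo x))) ≡⟨ proj₁ (counit (coyo x)) ⟩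
        ∣ sub X ∣ x            ≤⟨ hom-refl x ⟩
        hom X x x              ≤⟨ Below⇒≥ (f (g (coyo x))) (coyo x) (counit (coyo x)) x ⟩
        λrel (f (g (coyo x))) tt x ∎))
      where open GaloisConnection A (P† X) gal

  module Polarity (X Y : QPreSet) (X-pre : IsQPreordered X) (Y-pre : IsQPreordered Y)
                  (f : PEl X → P†El Y) (g : P†El Y → PEl X)
                  (gal : IsQGalois (P X) (P† Y) f g) where
    open GaloisConnection (P X) (P† Y) gal
    open Representables X X-pre using (yo; yoneda; hom-f-yo≤g)
    open Representables Y Y-pre using (hom-refl; hom-trans) renaming (hom-isQRel to homY-isQRel)
    open PresheafHom X
    open PresheafHom† Y

    φ : QRel (sub X) (sub Y)
    φ = qrel (λ x y → λrel (f (yo x)) tt y)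
             (λ x y → IsQRel-reweightˡ (f-weight (yo x)) (isQ (rel† (f (yo x)))) tt y)

    f-comp-≤-φ : (μ : PEl X) {w : Q} → proj₁ μ ≡ w →
                 LeR (sub X) (sub Y) (comp (sub X) (𝟏 w) (sub Y) (λrel (f μ)) (μrel μ)) (rel φ)
    f-comp-≤-φ μ refl x y = ⋁-lub λ _ → begin
      (λrel (f μ) tt y / proj₁ μ) & μrel μ x tt
        ≤⟨ &-monoʳ (≤-trans (yoneda μ x) (f-hom (yo x) μ)) ⟩
      (λrel (f μ) tt y / proj₁ μ) & hom (P† Y) (f (yo x)) (f μ)
        ≤⟨ homP†-sound (f (yo x)) (f μ) y (f-weight μ) ⟩
      λrel (f (yo x)) tt y ∎

    1∘φ≤φ : LeR (sub X) (sub Y) (comp (sub X) (sub Y) (sub Y) (hom Y) (rel φ)) (rel φ)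
    1∘φ≤φ x y = proj₂ (proj₂ (f (yo x))) tt y

    φ∘1≤φ : LeR (sub X) (sub Y) (comp (sub X) (sub X) (sub Y) (rel φ) (hom X)) (rel φ)
    φ∘1≤φ x' y = ⋁-lub λ x → ≤-trans (≤-⋁ tt ≤-refl) (f-comp-≤-φ (yo x) refl x' y)

    φ-isDistributor : IsDistributor X Y φ
    φ-isDistributor = closed⇒IsDistributor X Y φ 1∘φ≤φ φ∘1≤φ

    g-greatest : (l : P†El Y) (ρ : QRel (sub X) (𝟏 (proj₁ l))) →
                 LeR (sub X) (sub Y) (comp (sub X) (𝟏 (proj₁ l)) (sub Y) (λrel l) (rel ρ)) (rel φ) →
                 ∀ x → rel ρ x tt ≤ μrel (g l) x tt
    g-greatest l ρ l∘ρ≤φ x = ≤-trans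
      (homP†-greatest (f (yo x)) l (rel ρ x tt) refl
        (subst (λ p → D p (proj₁ l) (rel ρ x tt)) (sym (f-weight (yo x))) (isQ ρ x tt))
        (λ y → ≤-trans (≤-⋁ tt ≤-refl) (l∘ρ≤φ x y)))
      (hom-f-yo≤g (P† Y) f g gal x l)

    -- ψ need not be an upper set, so it is first replaced by its upper closure 1_Y ∘ ψ.
    f-greatest : (μ : PEl X) (ψ : QRel (𝟏 (proj₁ μ)) (sub Y)) →
                 LeR (sub X) (sub Y) (comp (sub X) (𝟏 (proj₁ μ)) (sub Y) (rel ψ) (μrel μ)) (rel φ) →
                 ∀ y → rel ψ tt y ≤ λrel (f μ) tt y
    f-greatest μ ψ ψ∘μ≤φ y = begin
      rel ψ tt y          ≤⟨ ≤-⋁ y (≤-trans ≤-p/p& (&-monoˡ (/-monoˡ (hom-refl y)))) ⟩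
      λrel l tt y         ≤⟨ Below⇒≥ (f (g l)) l (counit l) y ⟩
      λrel (f (g l)) tt y ≤⟨ Below⇒≥ (f μ) (f (g l)) (f-Below μ⊑gl) y ⟩
      λrel (f μ) tt y     ∎
      where
      q = proj₁ μ
      l : P†El Y
      l = comp-P†El Y Y (qrel (hom Y) homY-isQRel) hom-trans ψ
      l∘μ≤φ : LeR (sub X) (sub Y) (comp (sub X) (𝟏 q) (sub Y) (λrel l) (μrel μ)) (rel φ)
      l∘μ≤φ x y' = ≤-trans
        (comp-assoc-≥ {W = sub X} {X = 𝟏 q} {Y = sub Y} {Z = sub Y}
                      {c = hom Y} {b = rel ψ} {a = μrel μ}
          (isQ ψ) (isQ (relᴾ μ)) x y')
        (≤-trans (comp-mono {X = sub X} {Y = sub Y} {Z = sub Y} {ψ = hom Y}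
                            (λ _ _ → ≤-refl) ψ∘μ≤φ x y')
          (1∘φ≤φ x y'))
      μ⊑gl : Below (P X) μ (g l)
      μ⊑gl = ≤⇒Below μ (g l) (sym (g-weight l)) (g-greatest l (relᴾ μ) l∘μ≤φ)

    f-is-φ↑ : AgreesP† Y proj₁ f (φ↑ X Y φ)
    f-is-φ↑ μ = f-weight μ , λ { tt y → ≤-antisym (f≤φ↑ y) (φ↑≤f y) }
      where
      f≤φ↑ : ∀ y → λrel (f μ) tt y ≤ φ↑ X Y φ μ tt y
      f≤φ↑ = lift-greatest {X = sub X} {Y = 𝟏 (proj₁ μ)} {Z = sub Y}
        (qrel (λrel (f μ)) (IsQRel-reweightˡ (f-weight μ) (isQ (rel† (f μ)))))
        (f-comp-≤-φ μ refl) tt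

      φ↑≤f : ∀ y → φ↑ X Y φ μ tt y ≤ λrel (f μ) tt y
      φ↑≤f y = ⋁-lub λ (ψ , ψ∘μ≤φ) → f-greatest μ ψ ψ∘μ≤φ y

    g-is-φ↓ : AgreesP X proj₁ g (φ↓ X Y φ)
    g-is-φ↓ l = g-weight l , λ { x tt → ≤-antisym (g≤φ↓ x) (φ↓≤g x) }
      where
      q = proj₁ l

      l∘gl≤φ : LeR (sub X) (sub Y) (comp (sub X) (𝟏 q) (sub Y) (λrel l) (μrel (g l))) (rel φ)
      l∘gl≤φ x y = ≤-trans
        (comp-mono {X = sub X} {Y = 𝟏 q} {Z = sub Y} {φ = μrel (g l)}
                   (λ _ → Below⇒≥ (f (g l)) l (counit l)) (λ _ _ → ≤-refl) x y)
        (f-comp-≤-φ (g l) (g-weight l) x y)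

      φ↓≤g : ∀ x → φ↓ X Y φ l x tt ≤ μrel (g l) x tt
      φ↓≤g x = ⋁-lub λ (ρ , l∘ρ≤φ) → g-greatest l ρ l∘ρ≤φ x

      g≤φ↓ : ∀ x → μrel (g l) x tt ≤ φ↓ X Y φ l x tt
      g≤φ↓ x = ext-greatest {X = sub X} {Y = 𝟏 q} {Z = sub Y}
        (qrel (μrel (g l)) (IsQRel-reweightʳ (g-weight l) (isQ (relᴾ (g l))))) l∘gl≤φ x tt

  module Axiality (X Y : QPreSet) (X-pre : IsQPreordered X) (Y-pre : IsQPreordered Y)
                  (f : PEl X → PEl Y) (g : PEl Y → PEl X)
                  (gal : IsQGalois (P X) (P Y) f g) where
    open GaloisConnection (P X) (P Y) gal
    open Representables X X-pre using (yo; yoneda; hom-f-yo≤g)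
    open Representables Y Y-pre using () renaming (hom-isQRel to homY-isQRel)
    module PX = PresheafHom X
    module PY = PresheafHom Y

    φ : QRel (sub Y) (sub X)
    φ = qrel (λ y x → μrel (f (yo x)) y tt)
             (λ y x → IsQRel-reweightʳ (f-weight (yo x)) (isQ (PY.relᴾ (f (yo x)))) y tt)

    φ*-≤-f : ∀ μ y → φ* Y X φ μ y tt ≤ μrel (f μ) y tt
    φ*-≤-f μ y = ⋁-lub λ x → begin
      (μrel μ x tt / ∣ sub X ∣ x) & μrel (f (yo x)) y tt
        ≤⟨ &-monoˡ (/-monoˡ (≤-trans (yoneda μ x) (f-hom (yo x) μ))) ⟩
      (hom (P Y) (f (yo x)) (f μ) / ∣ sub X ∣ x) & μrel (f (yo x)) y tt
        ≤⟨ PY.homP-sound (f (yo x)) (f μ) y (f-weight (yo x)) ⟩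
      μrel (f μ) y tt ∎

    φ∘1≤φ : LeR (sub Y) (sub X) (comp (sub Y) (sub Y) (sub X) (rel φ) (hom Y)) (rel φ)
    φ∘1≤φ y x = proj₂ (proj₂ (f (yo x))) y tt

    1∘φ≤φ : LeR (sub Y) (sub X) (comp (sub Y) (sub X) (sub X) (hom X) (rel φ)) (rel φ)
    1∘φ≤φ y x = φ*-≤-f (yo x) y

    φ-isDistributor : IsDistributor Y X φ
    φ-isDistributor = closed⇒IsDistributor Y X φ 1∘φ≤φ φ∘1≤φ

    g-greatest : (ν : PEl Y) (ρ : QRel (sub X) (𝟏 (proj₁ ν))) →
                 LeR (sub Y) (𝟏 (proj₁ ν))
                     (comp (sub Y) (sub X) (𝟏 (proj₁ ν)) (rel ρ) (rel φ)) (μrel ν) →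
                 ∀ x → rel ρ x tt ≤ μrel (g ν) x tt
    g-greatest ν ρ ρ∘φ≤ν x = ≤-trans
      (PY.homP-greatest (f (yo x)) ν (rel ρ x tt) (f-weight (yo x)) (isQ ρ x tt)
        (λ y → ≤-trans (≤-⋁ x ≤-refl) (ρ∘φ≤ν y tt)))
      (hom-f-yo≤g (P Y) f g gal x ν)

    f-is-φ* : AgreesP Y proj₁ f (φ* Y X φ)
    f-is-φ* μ = f-weight μ , λ { y tt → ≤-antisym (f≤φ* y) (φ*-≤-f μ y) }
      where
      ν : PEl Y
      ν = comp-PEl Y X homY-isQRel φ φ∘1≤φ μ
      μ⊑gν : Below (P X) μ (g ν)
      μ⊑gν = PX.≤⇒Below μ (g ν) (sym (g-weight ν))
               (g-greatest ν (PX.relᴾ μ) (λ _ _ → ≤-refl))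
      f≤φ* : ∀ y → μrel (f μ) y tt ≤ φ* Y X φ μ y tt
      f≤φ* y = ≤-trans (PY.Below⇒≤ (f μ) (f (g ν)) (f-Below μ⊑gν) y)
                       (PY.Below⇒≤ (f (g ν)) ν (counit ν) y)

    g-is-φ₊ : AgreesP X proj₁ g (φ₊ Y X φ)
    g-is-φ₊ ν = g-weight ν , λ { x tt → ≤-antisym (g≤φ₊ x) (φ₊≤g x) }
      where
      φ₊≤g : ∀ x → φ₊ Y X φ ν x tt ≤ μrel (g ν) x tt
      φ₊≤g x = ⋁-lub λ (ρ , ρ∘φ≤ν) → g-greatest ν ρ ρ∘φ≤ν x

      g≤φ₊ : ∀ x → μrel (g ν) x tt ≤ φ₊ Y X φ ν x tt
      g≤φ₊ x = lift-greatest {X = sub Y} {Y = sub X} {Z = 𝟏 (proj₁ ν)}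
        (qrel (μrel (g ν)) (IsQRel-reweightʳ (g-weight ν) (isQ (PX.relᴾ (g ν)))))
        (λ y _ → ≤-trans (φ*-≤-f (g ν) y) (PY.Below⇒≤ (f (g ν)) ν (counit ν) y)) x tt

  module DualAxiality (X Y : QPreSet) (Y-pre : IsQPreordered Y)
                      (f : P†El X → P†El Y) (g : P†El Y → P†El X)
                      (gal : IsQGalois (P† X) (P† Y) f g) where
    open GaloisConnection (P† X) (P† Y) gal
    open Representables Y Y-pre using (coyo; coyoneda; hom-g-coyo≤f)
    module P†X = PresheafHom† X
    module P†Y = PresheafHom† Y

    φ : QRel (sub Y) (sub X)
    φ = qrel (λ y x → λrel (g (coyo y)) tt x)
             (λ y x → IsQRel-reweightˡ (g-weight (coyo y)) (isQ (P†X.rel† (g (coyo y)))) tt x)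

    φ†⁺-≤-g : ∀ l x → φ†⁺ Y X φ l tt x ≤ λrel (g l) tt x
    φ†⁺-≤-g l x = ⋁-lub λ y → begin
      (λrel (g (coyo y)) tt x / ∣ sub Y ∣ y) & λrel l tt y
        ≤⟨ &-monoʳ (≤-trans (coyoneda l y) (g-hom l (coyo y))) ⟩
      (λrel (g (coyo y)) tt x / ∣ sub Y ∣ y) & hom (P† X) (g l) (g (coyo y))
        ≤⟨ P†X.homP†-sound (g l) (g (coyo y)) x (g-weight (coyo y)) ⟩
      λrel (g l) tt x ∎

    1∘φ≤φ : LeR (sub Y) (sub X) (comp (sub Y) (sub X) (sub X) (hom X) (rel φ)) (rel φ)
    1∘φ≤φ y x = proj₂ (proj₂ (g (coyo y))) tt x

    φ∘1≤φ : LeR (sub Y) (sub X) (comp (sub Y) (sub Y) (sub X) (rel φ) (hom Y)) (rel φ)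
    φ∘1≤φ y x = φ†⁺-≤-g (coyo y) x

    φ-isDistributor : IsDistributor Y X φ
    φ-isDistributor = closed⇒IsDistributor Y X φ 1∘φ≤φ φ∘1≤φ

    f-greatest : (l : P†El X) (ρ : QRel (𝟏 (proj₁ l)) (sub Y)) →
                 LeR (𝟏 (proj₁ l)) (sub X)
                     (comp (𝟏 (proj₁ l)) (sub Y) (sub X) (rel φ) (rel ρ)) (λrel l) →
                 ∀ y → rel ρ tt y ≤ λrel (f l) tt y
    f-greatest l ρ φ∘ρ≤l y = ≤-trans
      (P†X.homP†-greatest l (g (coyo y)) (rel ρ tt y) (g-weight (coyo y)) (isQ ρ tt y)
        (λ x → ≤-trans (≤-⋁ y ≤-refl) (φ∘ρ≤l tt x)))
      (hom-g-coyo≤f (P† X) f g gal y l)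

    f-is-φ†₋ : AgreesP† Y proj₁ f (φ†₋ Y X φ)
    f-is-φ†₋ l = f-weight l , λ { tt y → ≤-antisym (f≤φ†₋ y) (φ†₋≤f y) }
      where
      φ†₋≤f : ∀ y → φ†₋ Y X φ l tt y ≤ λrel (f l) tt y
      φ†₋≤f y = ⋁-lub λ (ρ , φ∘ρ≤l) → f-greatest l ρ φ∘ρ≤l y

      f≤φ†₋ : ∀ y → λrel (f l) tt y ≤ φ†₋ Y X φ l tt y
      f≤φ†₋ = ext-greatest {X = 𝟏 (proj₁ l)} {Y = sub Y} {Z = sub X}
        (qrel (λrel (f l)) (IsQRel-reweightˡ (f-weight l) (isQ (P†Y.rel† (f l)))))
        (λ _ x → ≤-trans (φ†⁺-≤-g (f l) x) (P†X.Below⇒≥ l (g (f l)) (unit l) x)) tt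

    g-is-φ†⁺ : AgreesP† X proj₁ g (φ†⁺ Y X φ)
    g-is-φ†⁺ l = g-weight l , λ { tt x → ≤-antisym (g≤φ†⁺ x) (φ†⁺-≤-g l x) }
      where
      ν : P†El X
      ν = comp-P†El Y X φ 1∘φ≤φ (P†Y.rel† l)
      fν⊑l : Below (P† Y) (f ν) l
      fν⊑l = P†Y.≥⇒Below (f ν) l (f-weight ν)
               (f-greatest ν (P†Y.rel† l) (λ _ _ → ≤-refl))
      g≤φ†⁺ : ∀ x → λrel (g l) tt x ≤ φ†⁺ Y X φ l tt x
      g≤φ†⁺ x = ≤-trans (P†X.Below⇒≥ (g (f ν)) (g l) (g-Below fν⊑l) x)
                        (P†X.Below⇒≥ ν (g (f ν)) (unit ν) x)

proposition4p23 : (𝔔 : Quantale) → let open QTheory 𝔔 in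
    (X Y : QPreSet) → IsQPreordered X → IsQPreordered Y →
    ((f : PEl X → P†El Y) (g : P†El Y → PEl X) → IsQGalois (P X) (P† Y) f g →
      Σ (QRel (sub X) (sub Y)) (λ φ → IsDistributor X Y φ
        × AgreesP† Y proj₁ f (φ↑ X Y φ)
        × AgreesP X proj₁ g (φ↓ X Y φ)))
    × ((f : PEl X → PEl Y) (g : PEl Y → PEl X) → IsQGalois (P X) (P Y) f g →
      Σ (QRel (sub Y) (sub X)) (λ φ → IsDistributor Y X φ
        × AgreesP Y proj₁ f (φ* Y X φ)
        × AgreesP X proj₁ g (φ₊ Y X φ)))
    × ((f : P†El X → P†El Y) (g : P†El Y → P†El X) → IsQGalois (P† X) (P† Y) f g →
      Σ (QRel (sub Y) (sub X)) (λ φ → IsDistributor Y X φ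
        × AgreesP† Y proj₁ f (φ†₋ Y X φ)
        × AgreesP† X proj₁ g (φ†⁺ Y X φ)))
proposition4p23 𝔔 X Y X-pre Y-pre =
  (λ f g gal → let open Polarity 𝔔 X Y X-pre Y-pre f g gal
               in φ , φ-isDistributor , f-is-φ↑ , g-is-φ↓) ,
  (λ f g gal → let open Axiality 𝔔 X Y X-pre Y-pre f g gal
               in φ , φ-isDistributor , f-is-φ* , g-is-φ₊) ,
  (λ f g gal → let open DualAxiality 𝔔 X Y Y-pre f g gal
               in φ , φ-isDistributor , f-is-φ†₋ , g-is-φ†⁺)
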